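{- Let $(N_1,m_1)\vartriangleright_E(N_2,m_2)$ and let $G=(V,R,A)$ be a well-formed Token Flow Graph for this equivalence. If $m$ is a marking in $R(N_1,m_1)$ or in $R(N_2,m_2)$, then there exists a total, well-defined configuration $c$ of $G$ such that $c\equiv m$. Conversely, if $c$ is a total, well-defined configuration of $G$ and the marking $c_{\mid N_1}$ is reachable in $(N_1,m_1)$, then $c_{\mid N_2}$ is reachable in $(N_2,m_2)$.
   Context: Petri nets. A Petri net is $N=(P,T,\mathbf{pre},\mathbf{post})$ with finite disjoint sets of places $P$ and transitions $T$ and $\mathbf{pre},\mathbf{post}:T\to(P\to\mathbb{N})$. A marking is a map $m:P\to\mathbb{N}$. Transition $t$ is enabled at $m$ if $m(p)\ge\mathbf{pre}(t,p)$ for all $p$; firing it yields $m'=m-\mathbf{pre}(t)+\mathbf{post}(t)$. $R(N,m_0)$ is the set of markings reachable from $m_0$ by finite (possibly empty) sequences of firings. Equations. Solutions of a linear system $E$ (with variable set $\mathrm{fv}(E)$) are total non-negative integer assignments satisfying all equations; $E$ is consistent if it has one. Fix pairwise disjoint sets $K(n)$, $n\in\mathbb{N}$, of constant symbols (disjoint from place and variable names), $K=\bigcup_n K(n)$; a constant in $K(n)$ stands for $n$. Every equation of $E$ has the form $v=\sum_{x\in X}x$ with $X$ a nonempty finite set of variables and $v$ a variable or constant. For a partial map $m$ defined exactly on $x_1,\dots,x_k$, $\llbracket m\rrbracket$ is the system $x_1=m(x_1),\dots,x_k=m(x_k)$; commas denote union of systems. Two partial maps are compatible, $m\equiv m'$,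 if they agree wherever both are defined. $E$-equivalence: $(N_1,m_1)\vartriangleright_E(N_2,m_2)$ iff (A1) $E,\llbracket m\rrbracket$ is consistent for every $m\in R(N_1,m_1)\cup R(N_2,m_2)$; (A2) $E,\llbracket m_1\rrbracket,\llbracket m_2\rrbracket$ is consistent; (A3) for all markings $m_1'$ of $N_1$, $m_2'$ of $N_2$ with $E,\llbracket m_1'\rrbracket,\llbracket m_2'\rrbracket$ consistent, $m_1'\in R(N_1,m_1)$ iff $m_2'\in R(N_2,m_2)$. Token Flow Graphs. A TFG is $(V,R,A)$ with $V=P\cup S$, $S\subset K$ finite, and disjoint $R,A\subseteq V\times V$. Write $v\to\!\bullet\, w$ for $(v,w)\in R$, $v\circ\!\!\to w$ for $(v,w)\in A$, $v\to w$ for either. A root is a node that is the target of no arc. $v\circ\!\!\to X$ means $X$ is the nonempty set of all $w$ with $v\circ\!\!\to w$; $X\to\!\bullet\, v$ means $X$ is the nonempty set of all $w$ with $w\to\!\bullet\, v$. The TFG is well-formed for $(N_1,m_1)\vartriangleright_E(N_2,m_2)$ (place sets $P_1,P_2$) if: (T1) $V\setminus K=P_1\cup P_2\cup\mathrm{fv}(E)$; (T2) nodes in $V\cap K$ are roots; (T3) one cannot have $p\circ\!\!\to q$ and $p'\to q$ with $p\ne p'$, nor both $p\to\!\bullet\, q$ and $p\circ\!\!\to q$; (T4) $v\circ\!\!\to X$ or $X\to\!\bullet\, v$ holds iff the equation $v=\sum_{x\in X}x$ is in $E$. Configurations. A configuration is a partial function $c:V\to\mathbb{N}$ ($c(v)=\bot$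 when undefined) with $c(v)=n$ for all $v\in V\cap K(n)$; it is total if defined everywhere. It is well-defined if (CBot) whenever $v\to w$, $c(v)=\bot$ iff $c(w)=\bot$; and (CEq) whenever $c(v)\ne\bot$ and ($v\circ\!\!\to X$ or $X\to\!\bullet\, v$), $c(v)=\sum_{x\in X}c(x)$. For a net $N$, $c_{\mid N}$ is the restriction of $c$ to the places of $N$ (a marking of $N$ when $c$ is total). -}

module Defs where

open import Data.Nat using (ℕ; _+_; _≤_; _∸_)
open import Data.List using (List; []; _∷_; map)
open import Data.Nat.ListAction using (sum)
open import Data.List.Membership.Propositional using (_∈_; _∉_)
open import Data.List.Relation.Unary.Unique.Propositional using (Unique)
open import Data.Maybe using (Maybe; just; nothing; fromMaybe)
open import Data.Product using (Σ; ∃; _×_; _,_)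
open import Data.Sum using (_⊎_)
open import Relation.Nullary using (¬_)
open import Relation.Binary.PropositionalEquality using (_≡_)
open import Function.Bundles using (_⇔_)

-- Places and variables share one namespace of atoms (ℕ);
-- constant symbols are disjoint from them.  K(n) = { const n i | i : ℕ },
-- so the K(n) are pairwise disjoint and a constant in K(n) stands for n.

data Name : Set where
  atom  : ℕ → Name
  const : ℕ → ℕ → Name

constVal : Name → Maybe ℕ
constVal (atom _)    = nothing
constVal (const n _) = just n

-- Petri nets.  Places are atoms; pre/post are given on all atoms but
-- only their values on the places of the net matter.

record Transition : Set where
  field
    pre  : ℕ → ℕ
    post : ℕ → ℕ
open Transition public

record Net : Set where
  field
    places : List ℕ
    trans  : List Transition
open Net public

-- A marking assigns a number to every atom; only values on places matter.
Marking : Set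
Marking = ℕ → ℕ

Enabled : Net → Transition → Marking → Set
Enabled N t m = ∀ p → p ∈ places N → pre t p ≤ m p

fire : Transition → Marking → Marking
fire t m p = m p ∸ pre t p + post t p

data Reach (N : Net) (m₀ : Marking) : Marking → Set where
  base : Reach N m₀ m₀
  step : ∀ {m t} → Reach N m₀ m → t ∈ trans N → Enabled N t m →
         Reach N m₀ (fire t m)

_≈[_]_ : Marking → Net → Marking → Set
m ≈[ N ] m' = ∀ p → p ∈ places N → m p ≡ m' p

Reachable : Net → Marking → Marking → Set
Reachable N m₀ m = ∃ λ m' → Reach N m₀ m' × (m' ≈[ N ] m)

-- Linear systems: each equation  v = Σ_{x ∈ X} x  with v a variable or
-- a constant and X a nonempty finite set of variables (a duplicate-free
-- nonempty list of atoms).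

record Equation : Set where
  constructor _≐_
  field
    lhs : Name
    rhs : List ℕ
open Equation public

System : Set
System = List Equation

NonEmpty : {A : Set} → List A → Set
NonEmpty xs = ∃ λ y → y ∈ xs

WfSystem : System → Set
WfSystem E = ∀ e → e ∈ E → NonEmpty (rhs e) × Unique (rhs e)

_∈fv_ : ℕ → System → Set
a ∈fv E = ∃ λ e → e ∈ E × (lhs e ≡ atom a ⊎ a ∈ rhs e)

-- total assignments (values of atoms outside fv(E) are irrelevant)
Assignment : Set
Assignment = ℕ → ℕ

evalName : Assignment → Name → ℕ
evalName σ (atom a)    = σ a
evalName σ (const n _) = n

Solves : Assignment → System → Set
Solves σ E = ∀ e → e ∈ E → evalName σ (lhs e) ≡ sum (map σ (rhs e))

SatMarking : Assignment → Net → Marking → Set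
SatMarking σ N m = ∀ p → p ∈ places N → σ p ≡ m p

Consistent₁ : System → Net → Marking → Set
Consistent₁ E N m = ∃ λ σ → Solves σ E × SatMarking σ N m

Consistent₂ : System → Net → Marking → Net → Marking → Set
Consistent₂ E N₁ m₁ N₂ m₂ =
  ∃ λ σ → Solves σ E × SatMarking σ N₁ m₁ × SatMarking σ N₂ m₂

record EEquiv (N₁ : Net) (m₁ : Marking) (E : System)
              (N₂ : Net) (m₂ : Marking) : Set where
  field
    A1₁ : ∀ m → Reachable N₁ m₁ m → Consistent₁ E N₁ m
    A1₂ : ∀ m → Reachable N₂ m₂ m → Consistent₁ E N₂ m
    A2  : Consistent₂ E N₁ m₁ N₂ m₂
    A3  : ∀ m₁' m₂' → Consistent₂ E N₁ m₁' N₂ m₂' →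
          Reachable N₁ m₁ m₁' ⇔ Reachable N₂ m₂ m₂'

-- Token Flow Graphs.  R = redistribution arcs (v →• w),
-- A = agglomeration arcs (v ∘→ w).

record TFG : Set₁ where
  field
    V : List Name
    R : Name → Name → Set
    A : Name → Name → Set
    R⊆V×V : ∀ v w → R v w → v ∈ V × w ∈ V
    A⊆V×V : ∀ v w → A v w → v ∈ V × w ∈ V
    R∩A=∅ : ∀ v w → ¬ (R v w × A v w)
open TFG public

Arc : TFG → Name → Name → Set
Arc G v w = R G v w ⊎ A G v w

AggTo : TFG → Name → List Name → Set
AggTo G v X = NonEmpty X × (∀ w → A G v w ⇔ w ∈ X)

RedTo : TFG → List Name → Name → Set
RedTo G X v = NonEmpty X × (∀ w → R G w v ⇔ w ∈ X)

IsRoot : TFG → Name → Set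
IsRoot G v = ∀ w → ¬ Arc G w v

record WellFormed (N₁ N₂ : Net) (E : System) (G : TFG) : Set where
  field
    T1 : ∀ a → atom a ∈ V G ⇔ (a ∈ places N₁ ⊎ a ∈ places N₂ ⊎ a ∈fv E)
    T2 : ∀ n i → const n i ∈ V G → IsRoot G (const n i)
    T3a : ∀ p p' q → A G p q → Arc G p' q → p ≡ p'
    T3b : ∀ p q → ¬ (R G p q × A G p q)
    T4 : ∀ v (X : List Name) →
         (AggTo G v X ⊎ RedTo G X v) ⇔
         (∃ λ e → e ∈ E × lhs e ≡ v × (∀ w → w ∈ X ⇔ w ∈ map atom (rhs e)))

-- Configurations: partial functions V → ℕ (nothing = ⊥), undefined
-- outside V.

PConfig : Set
PConfig = Name → Maybe ℕ

IsConfig : TFG → PConfig → Set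
IsConfig G c = (∀ v → v ∉ V G → c v ≡ nothing)
             × (∀ n i → const n i ∈ V G → c (const n i) ≡ just n)

Total : TFG → PConfig → Set
Total G c = ∀ v → v ∈ V G → ∃ λ k → c v ≡ just k

addM : Maybe ℕ → Maybe ℕ → Maybe ℕ
addM (just a) (just b) = just (a + b)
addM _        _        = nothing

sumC : PConfig → List Name → Maybe ℕ
sumC c []       = just 0
sumC c (x ∷ xs) = addM (c x) (sumC c xs)

WellDefined : TFG → PConfig → Set
WellDefined G c =
    (∀ v w → Arc G v w → (c v ≡ nothing ⇔ c w ≡ nothing))
  × (∀ v k (X : List Name) → c v ≡ just k → Unique X →
       (AggTo G v X ⊎ RedTo G X v) → sumC c X ≡ just k)

Compatible : PConfig → Net → Marking → Set
Compatible c N m = ∀ p → p ∈ places N → ∀ k → c (atom p) ≡ just k → k ≡ m p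

-- c|N (only meaningful on the places of N, where c is defined if total)
restrict : PConfig → Marking
restrict c p = fromMaybe 0 (c (atom p))

{-# OPTIONS --safe #-}
-- A solution of E induces a configuration of G: evaluate every node of G
-- under it.  By (T4) the arcs of G encode exactly the equations of E, so
-- this configuration is well-defined; conversely the restriction of a
-- total well-defined configuration to the atoms solves E.  Hence every
-- marking consistent with E (in particular every reachable one, by (A1))
-- is the restriction of a configuration, and a configuration whose N₁-part
-- is reachable in N₁ has, by (A3), a reachable N₂-part.
module Submission where

open import Defs hiding (trans)
open import Data.Nat using (ℕ)
open import Data.Nat.ListAction using (sum)
open import Data.Nat.ListAction.Properties using (sum-↭)
open import Data.Nat.Properties using (_≟_)
open import Data.List using (List; []; _∷_; map)
open import Data.List.Properties using (map-∘)
open import Data.List.Membership.Propositional using (_∈_; _∉_)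
open import Data.List.Membership.Propositional.Properties using (∈-map⁻)
open import Data.List.Membership.Propositional.Properties.WithK using (unique∧set⇒bag)
open import Data.List.Relation.Binary.BagAndSetEquality using (_∼[_]_; set; ∼bag⇒↭)
open import Data.List.Relation.Binary.Permutation.Propositional.Properties using (map⁺)
open import Data.List.Relation.Unary.Any using (here; there)
open import Data.List.Relation.Unary.Unique.Propositional using (Unique)
import Data.List.Relation.Unary.Unique.Propositional.Properties as Unique
open import Data.Maybe using (just; nothing)
open import Data.Maybe.Properties using (just-injective)
open import Data.Product using (∃; _×_; _,_; proj₁; proj₂)
open import Data.Sum using (_⊎_; inj₁; inj₂)
open import Function.Base using (_∘_; id)
open import Function.Bundles using (_⇔_; mk⇔; Equivalence)
open import Relation.Binary.Definitions using (DecidableEquality)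
open import Relation.Binary.PropositionalEquality
open import Relation.Nullary using (yes; no; contradiction)
open import Relation.Nullary.Decidable using (map′; _×-dec_)

atom-injective : ∀ {a b} → atom a ≡ atom b → a ≡ b
atom-injective refl = refl

const-injective : ∀ {n i m j} → const n i ≡ const m j → n ≡ m × i ≡ j
const-injective refl = refl , refl

infix 4 _≟ᴺ_
_≟ᴺ_ : DecidableEquality Name
atom a    ≟ᴺ atom b    = map′ (cong atom) atom-injective (a ≟ b)
const n i ≟ᴺ const m j =
  map′ (λ (n≡m , i≡j) → cong₂ const n≡m i≡j) const-injective (n ≟ m ×-dec i ≟ j)
atom _    ≟ᴺ const _ _ = no λ ()
const _ _ ≟ᴺ atom _    = no λ ()

open import Data.List.Membership.DecPropositional _≟ᴺ_ using (_∈?_)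

sum-map-unique-set : ∀ {A : Set} (f : A → ℕ) {xs ys : List A} →
                     Unique xs → Unique ys → xs ∼[ set ] ys →
                     sum (map f xs) ≡ sum (map f ys)
sum-map-unique-set f uxs uys xs≈ys =
  sum-↭ (map⁺ f (∼bag⇒↭ (unique∧set⇒bag uxs uys xs≈ys)))

sumC-just : ∀ (c : PConfig) (g : Name → ℕ) X →
            (∀ x → x ∈ X → c x ≡ just (g x)) → sumC c X ≡ just (sum (map g X))
sumC-just c g []      _ = refl
sumC-just c g (x ∷ X) h
  rewrite h x (here refl) | sumC-just c g X (λ y y∈X → h y (there y∈X)) = refl

sum-evalName-atoms : ∀ (σ : Assignment) rs →
                     sum (map (evalName σ) (map atom rs)) ≡ sum (map σ rs)
sum-evalName-atoms σ rs = cong sum (sym (map-∘ rs))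

FlowEquation : TFG → Name → List Name → Set
FlowEquation G v X = AggTo G v X ⊎ RedTo G X v

flowEquation-lhs∈V : ∀ G {v X} → FlowEquation G v X → v ∈ V G
flowEquation-lhs∈V G (inj₁ ((w , w∈X) , agg)) =
  proj₁ (A⊆V×V G _ w (Equivalence.from (agg w) w∈X))
flowEquation-lhs∈V G (inj₂ ((w , w∈X) , red)) =
  proj₂ (R⊆V×V G w _ (Equivalence.from (red w) w∈X))

arc⇒∈V : ∀ G {v w} → Arc G v w → v ∈ V G × w ∈ V G
arc⇒∈V G (inj₁ r) = R⊆V×V G _ _ r
arc⇒∈V G (inj₂ a) = A⊆V×V G _ _ a

module _ {N₁ N₂ : Net} {E : System} {G : TFG}
         (wfE : WfSystem E) (wf : WellFormed N₁ N₂ E G) where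

  open WellFormed wf

  equation⇒flowEquation : ∀ {e} → e ∈ E → FlowEquation G (lhs e) (map atom (rhs e))
  equation⇒flowEquation {e} e∈E =
    Equivalence.from (T4 (lhs e) (map atom (rhs e))) (e , e∈E , refl , λ _ → mk⇔ id id)

  flowEquation⇒equation : ∀ {v X} → FlowEquation G v X →
                          ∃ λ e → e ∈ E × lhs e ≡ v × X ∼[ set ] map atom (rhs e)
  flowEquation⇒equation {v} {X} flow with Equivalence.to (T4 v X) flow
  ... | e , e∈E , lhs≡v , X≈rhs = e , e∈E , lhs≡v , λ {w} → X≈rhs w

  rhs-unique : ∀ {e} → e ∈ E → Unique (map atom (rhs e))
  rhs-unique e∈E = Unique.map⁺ atom-injective (proj₂ (wfE _ e∈E))

  rhs⊆V : ∀ {e x} → e ∈ E → x ∈ map atom (rhs e) → x ∈ V G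
  rhs⊆V {e} e∈E x∈rhs with ∈-map⁻ atom x∈rhs
  ... | a , a∈rhs , refl = Equivalence.from (T1 a) (inj₂ (inj₂ (e , e∈E , inj₂ a∈rhs)))

  configOf : Assignment → PConfig
  configOf σ v with v ∈? V G
  ... | yes _ = just (evalName σ v)
  ... | no  _ = nothing

  module _ (σ : Assignment) where

    configOf-∈ : ∀ {v} → v ∈ V G → configOf σ v ≡ just (evalName σ v)
    configOf-∈ {v} v∈V with v ∈? V G
    ... | yes _   = refl
    ... | no  v∉V = contradiction v∈V v∉V

    configOf-∉ : ∀ {v} → v ∉ V G → configOf σ v ≡ nothing
    configOf-∉ {v} v∉V with v ∈? V G
    ... | yes v∈V = contradiction v∈V v∉V
    ... | no  _   = refl

    configOf-just : ∀ {v k} → configOf σ v ≡ just k → evalName σ v ≡ k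
    configOf-just {v} eq with v ∈? V G
    configOf-just refl | yes _ = refl

    configOf-isConfig : IsConfig G (configOf σ)
    configOf-isConfig = (λ _ → configOf-∉) , (λ _ _ → configOf-∈)

    configOf-total : Total G (configOf σ)
    configOf-total v v∈V = evalName σ v , configOf-∈ v∈V

    configOf-wellDefined : Solves σ E → WellDefined G (configOf σ)
    configOf-wellDefined sol = cbot , ceq
      where
      defined : ∀ {v} → v ∈ V G → configOf σ v ≢ nothing
      defined v∈V eq with trans (sym eq) (configOf-∈ v∈V)
      ... | ()

      cbot : ∀ v w → Arc G v w → (configOf σ v ≡ nothing ⇔ configOf σ w ≡ nothing)
      cbot v w arc = mk⇔ (λ eq → contradiction eq (defined (proj₁ (arc⇒∈V G arc))))
                         (λ eq → contradiction eq (defined (proj₂ (arc⇒∈V G arc))))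

      ceq : ∀ v k X → configOf σ v ≡ just k → Unique X → FlowEquation G v X →
            sumC (configOf σ) X ≡ just k
      ceq v k X cv≡k uX flow with flowEquation⇒equation flow
      ... | e , e∈E , refl , X≈rhs = begin
        sumC (configOf σ) X                               ≡⟨ sumC-just _ _ X (λ _ → configOf-∈ ∘ X⊆V) ⟩
        just (sum (map (evalName σ) X))                   ≡⟨ cong just (sum-map-unique-set _ uX (rhs-unique e∈E) X≈rhs) ⟩
        just (sum (map (evalName σ) (map atom (rhs e))))  ≡⟨ cong just (sum-evalName-atoms σ (rhs e)) ⟩
        just (sum (map σ (rhs e)))                        ≡⟨ cong just (sym (sol e e∈E)) ⟩
        just (evalName σ (lhs e))                         ≡⟨ cong just (configOf-just cv≡k) ⟩
        just k                                            ∎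
        where
        open ≡-Reasoning
        X⊆V : ∀ {x} → x ∈ X → x ∈ V G
        X⊆V x∈X = rhs⊆V e∈E (Equivalence.to X≈rhs x∈X)

  consistent⇒config : ∀ N m → Consistent₁ E N m →
                      ∃ λ c → IsConfig G c × Total G c × WellDefined G c × Compatible c N m
  consistent⇒config N m (σ , sol , sat) =
    configOf σ , configOf-isConfig σ , configOf-total σ , configOf-wellDefined σ sol ,
    λ p p∈N k cp≡k → trans (sym (configOf-just σ cp≡k)) (sat p p∈N)

  module _ {c : PConfig} (isC : IsConfig G c) (tot : Total G c) where

    total⇒evalRestrict : ∀ {v} → v ∈ V G → c v ≡ just (evalName (restrict c) v)
    total⇒evalRestrict {atom a}    a∈V with tot (atom a) a∈V
    ... | k , ca≡k rewrite ca≡k = refl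
    total⇒evalRestrict {const n i} v∈V = proj₂ isC n i v∈V

    restrict-solves : WellDefined G c → Solves (restrict c) E
    restrict-solves (_ , ceq) e e∈E = just-injective (begin
      just (evalName σ (lhs e))                         ≡⟨ sym (ceq _ _ _ (total⇒evalRestrict lhs∈V) (rhs-unique e∈E) flow) ⟩
      sumC c (map atom (rhs e))                         ≡⟨ sumC-just c _ _ (λ _ x∈rhs → total⇒evalRestrict (rhs⊆V e∈E x∈rhs)) ⟩
      just (sum (map (evalName σ) (map atom (rhs e))))  ≡⟨ cong just (sum-evalName-atoms σ (rhs e)) ⟩
      just (sum (map σ (rhs e)))                        ∎)
      where
      open ≡-Reasoning
      σ : Assignment
      σ = restrict c
      flow : FlowEquation G (lhs e) (map atom (rhs e))
      flow = equation⇒flowEquation e∈E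
      lhs∈V : lhs e ∈ V G
      lhs∈V = flowEquation-lhs∈V G flow

theorem1 : (N₁ N₂ : Net) (m₁ m₂ : Marking) (E : System) (G : TFG) →
    WfSystem E → EEquiv N₁ m₁ E N₂ m₂ → WellFormed N₁ N₂ E G →
    ((∀ m → Reachable N₁ m₁ m →
        ∃ λ c → IsConfig G c × Total G c × WellDefined G c × Compatible c N₁ m)
     × (∀ m → Reachable N₂ m₂ m →
        ∃ λ c → IsConfig G c × Total G c × WellDefined G c × Compatible c N₂ m)
     × (∀ c → IsConfig G c → Total G c → WellDefined G c →
        Reachable N₁ m₁ (restrict c) → Reachable N₂ m₂ (restrict c)))
theorem1 N₁ N₂ m₁ m₂ E G wfE equiv wf =
  (λ m reach → consistent⇒config wfE wf N₁ m (A1₁ m reach)) ,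
  (λ m reach → consistent⇒config wfE wf N₂ m (A1₂ m reach)) ,
  λ c isC tot wd → Equivalence.to (A3 _ _ (restrict c , restrict-solves wfE wf isC tot wd ,
                                           (λ _ _ → refl) , (λ _ _ → refl)))
  where open EEquiv equiv
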